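{- The double coset $\Delta_n\Theta_\ell$ satisfies the following condition: the map $\Gamma\backslash\Delta_n\Theta_\ell \to \Gamma_1\backslash\Gamma_1\Delta_n\Theta_\ell$, $\Gamma\sigma\mapsto\Gamma_1\sigma$, is bijective; equivalently $|\Gamma\backslash\Delta_n\Theta_\ell| = |\Gamma_1\backslash\Gamma_1\Delta_n\Theta_\ell|$.
   Context: Let $N=\ell\ell'$ with $(\ell,\ell')=1$, let $\Gamma=\Gamma_0(N)=\{\gamma\in\mathrm{SL}_2(\mathbb Z): N\mid c_\gamma\}$ and $\Gamma_1=\mathrm{SL}_2(\mathbb Z)$, and let $n\ge 1$. Let $\Delta_n=\{\sigma=\left(\begin{smallmatrix} a&b\\ c&d\end{smallmatrix}\right)\in M_2(\mathbb Z): \det\sigma=n,\ N\mid c,\ (a,N)=1\}$. Let $\Theta_\ell=\Gamma w_\ell\Gamma$, where $w_\ell=\left(\begin{smallmatrix} \ell x & y\\ Nz & \ell t\end{smallmatrix}\right)$ with $x,y,z,t\in\mathbb Z$ and $\det w_\ell=\ell$ (the Atkin–Lehner double coset). Then $\Delta_n\Theta_\ell=\{\left(\begin{smallmatrix} a&b\\ c&d\end{smallmatrix}\right)\in M_2(\mathbb Z): ad-bc=\ell n,\ N\mid c,\ \ell\mid a+d,\ \ell\mid a,\ (a,\ell')=1,\ (b,\ell)=1\}$. -}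

module Defs where

open import Data.Nat as ℕ using (ℕ)
open import Data.Nat.Coprimality using (Coprime)
open import Data.Integer using (ℤ; +_; _+_; _-_; _*_; ∣_∣)
open import Data.Integer.Divisibility using (_∣_)
open import Data.Product using (Σ; ∃; _×_; _,_)
open import Relation.Binary.PropositionalEquality using (_≡_)

record M2 : Set where
  constructor mat
  field
    a b c d : ℤ
open M2 public

_·_ : M2 → M2 → M2
mat a₁ b₁ c₁ d₁ · mat a₂ b₂ c₂ d₂ =
  mat (a₁ * a₂ + b₁ * c₂) (a₁ * b₂ + b₁ * d₂)
      (c₁ * a₂ + d₁ * c₂) (c₁ * b₂ + d₁ * d₂)

det : M2 → ℤ
det (mat a b c d) = a * d - b * c

InΓ₁ : M2 → Set
InΓ₁ γ = det γ ≡ + 1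

InΓ₀ : ℕ → M2 → Set
InΓ₀ N γ = InΓ₁ γ × (+ N) ∣ c γ

-- Δ_n Θ_ℓ, via its explicit description (given in the context), with N = ℓ ℓ'
InΔΘ : (ℓ ℓ' n : ℕ) → M2 → Set
InΔΘ ℓ ℓ' n (mat a b c d) =
  (a * d - b * c ≡ + (ℓ ℕ.* n)) ×
  ((+ (ℓ ℕ.* ℓ')) ∣ c) ×
  ((+ ℓ) ∣ (a + d)) ×
  ((+ ℓ) ∣ a) ×
  Coprime (∣ a ∣) ℓ' ×
  Coprime (∣ b ∣) ℓ

InΓ₁ΔΘ : (ℓ ℓ' n : ℕ) → M2 → Set
InΓ₁ΔΘ ℓ ℓ' n τ = Σ M2 λ γ → Σ M2 λ σ → InΓ₁ γ × InΔΘ ℓ ℓ' n σ × τ ≡ γ · σ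

-- Right cosets:  G σ = G τ  iff  τ = γ σ for some γ ∈ G
SameCoset : (M2 → Set) → M2 → M2 → Set
SameCoset G σ τ = Σ M2 λ γ → G γ × τ ≡ γ · σ

{-# OPTIONS --safe #-}
module Submission where

open import Defs
open import Data.Nat using (ℕ; _*_; _≤_)
open import Data.Nat.Coprimality using (Coprime)
open import Data.Product using (Σ; _×_; _,_)

import Data.Nat.Coprimality as ℕ
import Data.Nat.Divisibility as ℕ
open import Data.Nat.LCM using (lcm; lcm-least; gcd*lcm)
open import Data.Nat.Properties using (*-identityˡ)
import Data.Integer as ℤ
open import Data.Integer using (+_)
open import Data.Integer.Properties using (*-comm)
import Data.Integer.Coprimality as ℤ
open import Data.Integer.Divisibility using (_∣_)
import Data.Integer.Divisibility.Signed as Signed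
open import Relation.Binary.PropositionalEquality using (_≡_; refl; sym; trans; subst)

-- If σ' = γσ with γ = (p q ; r s) ∈ SL₂(ℤ) and σ, σ' ∈ Δ_n Θ_ℓ, then c' = r a + s c and
-- d' = r b + s d.  Now ℓ' divides c and c' and is prime to a, so ℓ' ∣ r; and ℓ divides
-- d and d' (as ℓ ∣ a and ℓ ∣ a + d) and is prime to b, so ℓ ∣ r.  Hence N = ℓ ℓ' ∣ r,
-- i.e. γ ∈ Γ₀(N).  Well-definedness and surjectivity of Γσ ↦ Γ₁σ are formal.

coprime⇒*-∣ : ∀ {m n k} → Coprime m n → m ℕ.∣ k → n ℕ.∣ k → m * n ℕ.∣ k
coprime⇒*-∣ {m} {n} m⊥n m∣k n∣k = subst (ℕ._∣ _) lcm≡m*n (lcm-least m∣k n∣k)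
  where
  lcm≡m*n : lcm m n ≡ m * n
  lcm≡m*n = trans (sym (*-identityˡ (lcm m n)))
                  (subst (λ g → g * lcm m n ≡ m * n) (ℕ.coprime⇒gcd≡1 m⊥n) (gcd*lcm m n))

coprime-∣-*+ : ∀ k x y z w → ℤ.Coprime k y → k ∣ x ℤ.* y ℤ.+ z ℤ.* w → k ∣ w → k ∣ x
coprime-∣-*+ k x y z w k⊥y k∣sum k∣w =
  ℤ.coprime-divisor k y x k⊥y (subst (k ∣_) (*-comm x y) k∣x*y)
  where
  k∣x*y : k ∣ x ℤ.* y
  k∣x*y = Signed.∣⇒∣ᵤ (Signed.∣m+n∣n⇒∣m {k} {x ℤ.* y}
                         (Signed.∣ᵤ⇒∣ {k} {x ℤ.* y ℤ.+ z ℤ.* w} k∣sum)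
                         (Signed.∣n⇒∣m*n z (Signed.∣ᵤ⇒∣ {k} {w} k∣w)))

∣c[γσ]⇒∣c[γ] : ∀ k γ σ → ℤ.Coprime k (a σ) → k ∣ c σ → k ∣ c (γ · σ) → k ∣ c γ
∣c[γσ]⇒∣c[γ] k γ σ k⊥a k∣c k∣c[γσ] = coprime-∣-*+ k (c γ) (a σ) (d γ) (c σ) k⊥a k∣c[γσ] k∣c

∣d[γσ]⇒∣c[γ] : ∀ k γ σ → ℤ.Coprime k (b σ) → k ∣ d σ → k ∣ d (γ · σ) → k ∣ c γ
∣d[γσ]⇒∣c[γ] k γ σ k⊥b k∣d k∣d[γσ] = coprime-∣-*+ k (c γ) (b σ) (d γ) (d σ) k⊥b k∣d[γσ] k∣d

SameCoset-mono : ∀ {G H : M2 → Set} → (∀ {γ} → G γ → H γ) →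
                 ∀ {σ τ} → SameCoset G σ τ → SameCoset H σ τ
SameCoset-mono G⊆H (γ , γ∈G , τ≡γσ) = γ , G⊆H γ∈G , τ≡γσ

module _ {ℓ ℓ' n : ℕ} where

  InΔΘ⇒ℓ'∣c : ∀ σ → InΔΘ ℓ ℓ' n σ → + ℓ' ∣ c σ
  InΔΘ⇒ℓ'∣c σ (_ , N∣c , _) = ℕ.∣-trans (ℕ.n∣m*n ℓ) N∣c

  InΔΘ⇒ℓ∣d : ∀ σ → InΔΘ ℓ ℓ' n σ → + ℓ ∣ d σ
  InΔΘ⇒ℓ∣d σ (_ , _ , ℓ∣a+d , ℓ∣a , _) =
    Signed.∣⇒∣ᵤ {+ ℓ} {d σ} (Signed.∣m+n∣m⇒∣n (Signed.∣ᵤ⇒∣ {+ ℓ} {a σ ℤ.+ d σ} ℓ∣a+d)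
                                               (Signed.∣ᵤ⇒∣ {+ ℓ} {a σ} ℓ∣a))

  InΔΘ⇒ℓ'⊥a : ∀ σ → InΔΘ ℓ ℓ' n σ → ℤ.Coprime (+ ℓ') (a σ)
  InΔΘ⇒ℓ'⊥a σ (_ , _ , _ , _ , a⊥ℓ' , _) = ℕ.sym a⊥ℓ'

  InΔΘ⇒ℓ⊥b : ∀ σ → InΔΘ ℓ ℓ' n σ → ℤ.Coprime (+ ℓ) (b σ)
  InΔΘ⇒ℓ⊥b σ (_ , _ , _ , _ , _ , b⊥ℓ) = ℕ.sym b⊥ℓ

  ΔΘ-transition-∈Γ₀ : Coprime ℓ ℓ' → ∀ γ σ → InΔΘ ℓ ℓ' n σ → InΔΘ ℓ ℓ' n (γ · σ) →
                      + (ℓ * ℓ') ∣ c γ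
  ΔΘ-transition-∈Γ₀ ℓ⊥ℓ' γ σ σ∈ΔΘ γσ∈ΔΘ = coprime⇒*-∣ ℓ⊥ℓ' ℓ∣c[γ] ℓ'∣c[γ]
    where
    ℓ∣c[γ] : + ℓ ∣ c γ
    ℓ∣c[γ] = ∣d[γσ]⇒∣c[γ] (+ ℓ) γ σ
               (InΔΘ⇒ℓ⊥b σ σ∈ΔΘ) (InΔΘ⇒ℓ∣d σ σ∈ΔΘ) (InΔΘ⇒ℓ∣d (γ · σ) γσ∈ΔΘ)
    ℓ'∣c[γ] : + ℓ' ∣ c γ
    ℓ'∣c[γ] = ∣c[γσ]⇒∣c[γ] (+ ℓ') γ σ
                (InΔΘ⇒ℓ'⊥a σ σ∈ΔΘ) (InΔΘ⇒ℓ'∣c σ σ∈ΔΘ) (InΔΘ⇒ℓ'∣c (γ · σ) γσ∈ΔΘ)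

  Γ₁-coset⇒Γ₀-coset : Coprime ℓ ℓ' → ∀ σ σ' → InΔΘ ℓ ℓ' n σ → InΔΘ ℓ ℓ' n σ' →
                      SameCoset InΓ₁ σ σ' → SameCoset (InΓ₀ (ℓ * ℓ')) σ σ'
  Γ₁-coset⇒Γ₀-coset ℓ⊥ℓ' σ σ' σ∈ΔΘ σ'∈ΔΘ (γ , γ∈Γ₁ , refl) =
    γ , (γ∈Γ₁ , ΔΘ-transition-∈Γ₀ ℓ⊥ℓ' γ σ σ∈ΔΘ σ'∈ΔΘ) , refl

lemma4p3 : (ℓ ℓ' n : ℕ) → 1 ≤ ℓ → 1 ≤ ℓ' → Coprime ℓ ℓ' → 1 ≤ n →
    -- the map Γσ ↦ Γ₁σ is well defined
    ((σ σ' : M2) → InΔΘ ℓ ℓ' n σ → InΔΘ ℓ ℓ' n σ' →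
      SameCoset (InΓ₀ (ℓ * ℓ')) σ σ' → SameCoset InΓ₁ σ σ')
    -- injective
    × ((σ σ' : M2) → InΔΘ ℓ ℓ' n σ → InΔΘ ℓ ℓ' n σ' →
      SameCoset InΓ₁ σ σ' → SameCoset (InΓ₀ (ℓ * ℓ')) σ σ')
    -- surjective onto Γ₁ \ Γ₁ Δ_n Θ_ℓ
    × ((τ : M2) → InΓ₁ΔΘ ℓ ℓ' n τ →
      Σ M2 λ σ → InΔΘ ℓ ℓ' n σ × SameCoset InΓ₁ σ τ)
lemma4p3 ℓ ℓ' n _ _ ℓ⊥ℓ' _ =
    (λ _ _ _ _ → SameCoset-mono (λ (γ∈Γ₁ , _) → γ∈Γ₁))
  , Γ₁-coset⇒Γ₀-coset ℓ⊥ℓ'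
  , λ { _ (γ , σ , γ∈Γ₁ , σ∈ΔΘ , τ≡γσ) → σ , σ∈ΔΘ , γ , γ∈Γ₁ , τ≡γσ }
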